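{- Let $t \ge 3$ be an integer and let $G$ be a finite simple connected graph. Then $M_t(G)$ is a regular graph if and only if $G \cong K_2$.
   Context: For a graph $G=(V,E)$ and an integer $t \ge 1$, the generalised Mycielskian $M_t(G)$ is the graph with vertex set $(V \times \{0,1,\dots,t-1\}) \cup \{u\}$ (where $u$ is a new vertex), whose edges are: $(x,0)(y,0)$ for every edge $xy \in E$; $(x,i)(y,i+1)$ for every $0 \le i \le t-2$ and every ordered pair $(x,y)$ with $xy \in E$; and $(x,t-1)u$ for every $x \in V$. -}

module Defs where

open import Data.Nat using (ℕ; zero; suc; _∸_; _≡ᵇ_)
open import Data.Fin using (Fin; toℕ)
open import Data.Fin.Properties using () renaming (_≟_ to _≟F_)
open import Data.Bool using (Bool; true; false; _∧_; _∨_; not)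
import Data.Bool
open import Data.Product using (_×_; _,_; ∃)
open import Data.Sum using (_⊎_; inj₁; inj₂)
open import Data.Unit using (⊤; tt)
open import Data.List using (List; length; filter; map; _++_; [_]; cartesianProduct; allFin)
open import Relation.Nullary.Decidable using (⌊_⌋)
open import Relation.Binary.PropositionalEquality using (_≡_)
open import Function.Bundles using (_↔_; Inverse)

record Graph (n : ℕ) : Set where
  field
    adj   : Fin n → Fin n → Bool
    sym   : ∀ x y → adj x y ≡ adj y x
    irrefl : ∀ x → adj x x ≡ false
open Graph public

data Reachable {n : ℕ} (G : Graph n) : Fin n → Fin n → Set where
  here : ∀ {x} → Reachable G x x
  step : ∀ {x y z} → adj G x y ≡ true → Reachable G y z → Reachable G x z

Connected : {n : ℕ} → Graph n → Set
Connected {n} G = Fin n × (∀ x y → Reachable G x y)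

K₂adj : Fin 2 → Fin 2 → Bool
K₂adj i j = not ⌊ i ≟F j ⌋

IsoK₂ : {n : ℕ} → Graph n → Set
IsoK₂ {n} G = ∃ λ (f : Fin n ↔ Fin 2) →
  ∀ x y → adj G x y ≡ K₂adj (Inverse.to f x) (Inverse.to f y)

-- Generalised Mycielskian M_t(G): vertices (x , i) with i : Fin t, plus u
MVertex : ℕ → ℕ → Set
MVertex n t = (Fin n × Fin t) ⊎ ⊤

mycVertices : (n t : ℕ) → List (MVertex n t)
mycVertices n t = map inj₁ (cartesianProduct (allFin n) (allFin t)) ++ [ inj₂ tt ]

mycAdj : {n : ℕ} (t : ℕ) → Graph n → MVertex n t → MVertex n t → Bool
mycAdj t G (inj₁ (x , i)) (inj₁ (y , j)) =
  adj G x y ∧ (((toℕ i ≡ᵇ 0) ∧ (toℕ j ≡ᵇ 0))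
               ∨ (toℕ j ≡ᵇ suc (toℕ i))
               ∨ (toℕ i ≡ᵇ suc (toℕ j)))
mycAdj t G (inj₁ (x , i)) (inj₂ _) = toℕ i ≡ᵇ (t ∸ 1)
mycAdj t G (inj₂ _) (inj₁ (y , j)) = toℕ j ≡ᵇ (t ∸ 1)
mycAdj t G (inj₂ _) (inj₂ _) = false

mycDegree : {n : ℕ} (t : ℕ) → Graph n → MVertex n t → ℕ
mycDegree {n} t G v = length (filter (λ w → mycAdj t G v w Data.Bool.≟ true) (mycVertices n t))

MycRegular : {n : ℕ} (t : ℕ) → Graph n → Set
MycRegular {n} t G = ∃ λ (k : ℕ) → ∀ (v : MVertex n t) → mycDegree t G v ≡ k

{-# OPTIONS --safe #-}
-- In M_t(G) the vertex (x , i) has degree deg(x) · c(i) + [i = t - 1], where c(i) is the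
-- number of layers adjacent to layer i, and the apex has degree |V(G)|.  Layer 0 is adjacent
-- to itself, so layer i is adjacent to layers i - 1 (read as 0 when i = 0) and i + 1 (when it
-- exists); hence c(i) + [i = t - 1] = 2 and K₂ yields a 2-regular graph.  Conversely, for
-- t ≥ 2, comparing layer 0 (degree 2 deg(x)) with the last layer (degree deg(x) + 1) forces
-- deg(x) = 1, and then the apex forces |V(G)| = 2.
module Submission where

open import Defs hiding (sym)

open import Data.Bool using (Bool; true; false; not; _∧_; _∨_; T)
open import Data.Bool.Properties using (∨-comm; ∨-identityʳ; T-≡)
open import Data.Empty using (⊥-elim)
open import Data.Fin using (Fin; zero; suc; toℕ; fromℕ; _≟_)
open import Data.Fin.Properties using (toℕ-fromℕ; toℕ<n)
open import Data.Fin.Permutation using (↔⇒≡)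
open import Data.List using (List; _++_; length; filter; map; tabulate; allFin; cartesianProduct)
import Data.List as List
open import Data.List.Properties using (map-++; map-∘)
open import Data.Nat using (ℕ; zero; suc; pred; _+_; _*_; _∸_; _≡ᵇ_; _<ᵇ_; _<_; _≤_; _≥_; s≤s; z≤n; z<s)
open import Data.Nat.ListAction using () renaming (sum to sumᴸ)
open import Data.Nat.ListAction.Properties using () renaming (sum-++ to sumᴸ-++)
open import Data.Nat.Properties
  using (+-*-semiring; +-identityʳ; +-assoc; *-comm; *-identityʳ; *-identityˡ; +-cancelˡ-≡;
         +-cancelʳ-≡; ≡ᵇ⇒≡; ≡⇒≡ᵇ; <⇒<ᵇ; <⇒≢; ≤-trans; pred[n]≤n; n<1+n)
open import Data.Product using (_×_; _,_; proj₁)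
open import Data.Sum using (inj₁; inj₂)
open import Data.Unit using (tt)
open import Algebra.Properties.Semiring.Sum +-*-semiring
  using (sum-syntax; sum-cong-≗; ∑-distrib-+; *-distribˡ-sum; *-distribʳ-sum; sum-replicate-zero)
open import Function using (_∘_; id; Equivalence; Injection; _⇔_; mk⇔)
open import Function.Properties.Inverse using (↔-refl; ↔⇒↣)
open import Relation.Binary.PropositionalEquality
  using (_≡_; _≢_; refl; sym; trans; cong; cong₂; module ≡-Reasoning)
open import Relation.Nullary.Decidable using (⌊_⌋; dec-no)

open ≡-Reasoning

private
  variable
    A B : Set
    n t : ℕ

iverson : Bool → ℕ
iverson true  = 1
iverson false = 0

iverson-∧ : ∀ a b → iverson (a ∧ b) ≡ iverson a * iverson b
iverson-∧ true  b = sym (+-identityʳ (iverson b))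
iverson-∧ false b = refl

iverson-∨ : ∀ a b → a ∧ b ≡ false → iverson (a ∨ b) ≡ iverson a + iverson b
iverson-∨ true  false _ = refl
iverson-∨ false b     _ = refl

iverson-T : ∀ {b} → T b → iverson b ≡ 1
iverson-T {true} _ = refl

iverson≡1⇒≡true : ∀ {b} → iverson b ≡ 1 → b ≡ true
iverson≡1⇒≡true {true} _ = refl

≡ᵇ-sym : ∀ a b → (a ≡ᵇ b) ≡ (b ≡ᵇ a)
≡ᵇ-sym zero    zero    = refl
≡ᵇ-sym zero    (suc b) = refl
≡ᵇ-sym (suc a) zero    = refl
≡ᵇ-sym (suc a) (suc b) = ≡ᵇ-sym a b

≡ᵇ-disjoint : ∀ a {b c} → b ≢ c → (a ≡ᵇ b) ∧ (a ≡ᵇ c) ≡ false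
≡ᵇ-disjoint a {b} {c} b≢c with a ≡ᵇ b in a≡b | a ≡ᵇ c in a≡c
... | false | _     = refl
... | true  | false = refl
... | true  | true  = ⊥-elim (b≢c (trans (sym (≡ᵇ-true⇒≡ b a≡b)) (≡ᵇ-true⇒≡ c a≡c)))
  where
  ≡ᵇ-true⇒≡ : ∀ d → (a ≡ᵇ d) ≡ true → a ≡ d
  ≡ᵇ-true⇒≡ d eq = ≡ᵇ⇒≡ a d (Equivalence.from T-≡ eq)

count : (A → Bool) → List A → ℕ
count p = sumᴸ ∘ map (iverson ∘ p)

length-filter≡count : (p : A → Bool) (xs : List A) →
  length (filter (λ x → p x Data.Bool.≟ true) xs) ≡ count p xs
length-filter≡count p List.[] = refl
length-filter≡count p (x List.∷ xs) with p x
... | true  = cong suc (length-filter≡count p xs)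
... | false = length-filter≡count p xs

count-++ : (p : A → Bool) (xs ys : List A) → count p (xs ++ ys) ≡ count p xs + count p ys
count-++ p xs ys =
  trans (cong sumᴸ (map-++ (iverson ∘ p) xs ys)) (sumᴸ-++ (map (iverson ∘ p) xs) (map (iverson ∘ p) ys))

count-map : (p : B → Bool) (f : A → B) (xs : List A) → count p (map f xs) ≡ count (p ∘ f) xs
count-map p f xs = cong sumᴸ (sym (map-∘ xs))

count-tabulate : (p : A → Bool) (f : Fin n → A) →
  count p (tabulate f) ≡ ∑[ i < n ] iverson (p (f i))
count-tabulate {n = zero}  p f = refl
count-tabulate {n = suc n} p f = cong (iverson (p (f zero)) +_) (count-tabulate p (f ∘ suc))

count-cartesianProduct : (p : A × B → Bool) (f : Fin n → A) (ys : List B) →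
  count p (cartesianProduct (tabulate f) ys) ≡ ∑[ i < n ] count (λ y → p (f i , y)) ys
count-cartesianProduct {n = zero}  p f ys = refl
count-cartesianProduct {n = suc n} p f ys =
  trans (count-++ p (map (f zero ,_) ys) _)
        (cong₂ _+_ (count-map p (f zero ,_) ys) (count-cartesianProduct p (f ∘ suc) ys))

∑-one : ∀ n → ∑[ _ < n ] 1 ≡ n
∑-one zero    = refl
∑-one (suc n) = cong suc (∑-one n)

∑-iverson-toℕ≡ᵇ : ∀ t b → ∑[ j < t ] iverson (toℕ j ≡ᵇ b) ≡ iverson (b <ᵇ t)
∑-iverson-toℕ≡ᵇ zero    b       = refl
∑-iverson-toℕ≡ᵇ (suc t) zero    = cong suc (sum-replicate-zero t)
∑-iverson-toℕ≡ᵇ (suc t) (suc b) = ∑-iverson-toℕ≡ᵇ t b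

∑-iverson-∨ : (p q : Fin n → Bool) → (∀ j → p j ∧ q j ≡ false) →
  ∑[ j < n ] iverson (p j ∨ q j) ≡ ∑[ j < n ] iverson (p j) + ∑[ j < n ] iverson (q j)
∑-iverson-∨ p q disjoint =
  trans (sum-cong-≗ (λ j → iverson-∨ (p j) (q j) (disjoint j)))
        (∑-distrib-+ (iverson ∘ p) (iverson ∘ q))

degree : Graph n → Fin n → ℕ
degree {n} G x = ∑[ y < n ] iverson (adj G x y)

-- On two layer vertices (x , i) and (y , j), mycAdj computes to adj G x y ∧ layerAdj (toℕ i) (toℕ j).
layerAdj : ℕ → ℕ → Bool
layerAdj a b = ((a ≡ᵇ 0) ∧ (b ≡ᵇ 0)) ∨ (b ≡ᵇ suc a) ∨ (a ≡ᵇ suc b)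

layerDegree : ℕ → ℕ → ℕ
layerDegree t a = ∑[ j < t ] iverson (layerAdj a (toℕ j))

isLastLayer : ℕ → ℕ → Bool
isLastLayer t a = a ≡ᵇ t ∸ 1

layerAdj-pred-suc : ∀ a b → layerAdj a b ≡ (b ≡ᵇ pred a) ∨ (b ≡ᵇ suc a)
layerAdj-pred-suc zero    b = cong ((b ≡ᵇ 0) ∨_) (∨-identityʳ (b ≡ᵇ 1))
layerAdj-pred-suc (suc a) b =
  trans (∨-comm (b ≡ᵇ suc (suc a)) (a ≡ᵇ b)) (cong (_∨ (b ≡ᵇ suc (suc a))) (≡ᵇ-sym a b))

layerDegree-pred-suc : ∀ t a → layerDegree t a ≡ iverson (pred a <ᵇ t) + iverson (suc a <ᵇ t)
layerDegree-pred-suc t a = begin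
  ∑[ j < t ] iverson (layerAdj a (toℕ j))
    ≡⟨ sum-cong-≗ (λ (j : Fin t) → cong iverson (layerAdj-pred-suc a (toℕ j))) ⟩
  ∑[ j < t ] iverson ((toℕ j ≡ᵇ pred a) ∨ (toℕ j ≡ᵇ suc a))
    ≡⟨ ∑-iverson-∨ {n = t} (λ j → toℕ j ≡ᵇ pred a) (λ j → toℕ j ≡ᵇ suc a)
                   (λ j → ≡ᵇ-disjoint (toℕ j) (<⇒≢ (s≤s pred[n]≤n))) ⟩
  ∑[ j < t ] iverson (toℕ j ≡ᵇ pred a) + ∑[ j < t ] iverson (toℕ j ≡ᵇ suc a)
    ≡⟨ cong₂ _+_ (∑-iverson-toℕ≡ᵇ t (pred a)) (∑-iverson-toℕ≡ᵇ t (suc a)) ⟩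
  iverson (pred a <ᵇ t) + iverson (suc a <ᵇ t) ∎

iverson-<ᵇ+iverson-≡ᵇ : ∀ {a b} → a ≤ b → iverson (a <ᵇ b) + iverson (a ≡ᵇ b) ≡ 1
iverson-<ᵇ+iverson-≡ᵇ {b = zero}  z≤n       = refl
iverson-<ᵇ+iverson-≡ᵇ {b = suc b} z≤n       = refl
iverson-<ᵇ+iverson-≡ᵇ             (s≤s a≤b) = iverson-<ᵇ+iverson-≡ᵇ a≤b

layerDegree+isLastLayer : ∀ t a → a < t → layerDegree t a + iverson (isLastLayer t a) ≡ 2
layerDegree+isLastLayer (suc t) a (s≤s a≤t) = begin
  layerDegree (suc t) a + iverson (a ≡ᵇ t)
    ≡⟨ cong (_+ iverson (a ≡ᵇ t)) (layerDegree-pred-suc (suc t) a) ⟩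
  iverson (pred a <ᵇ suc t) + iverson (a <ᵇ t) + iverson (a ≡ᵇ t)
    ≡⟨ +-assoc (iverson (pred a <ᵇ suc t)) _ _ ⟩
  iverson (pred a <ᵇ suc t) + (iverson (a <ᵇ t) + iverson (a ≡ᵇ t))
    ≡⟨ cong₂ _+_ (iverson-T (<⇒<ᵇ (s≤s (≤-trans pred[n]≤n a≤t)))) (iverson-<ᵇ+iverson-≡ᵇ a≤t) ⟩
  2 ∎

mycDegree≡∑ : (G : Graph n) (v : MVertex n t) →
  mycDegree t G v ≡ ∑[ y < n ] ∑[ j < t ] iverson (mycAdj t G v (inj₁ (y , j)))
                    + iverson (mycAdj t G v (inj₂ tt))
mycDegree≡∑ {n} {t} G v = begin
  mycDegree t G v
    ≡⟨ length-filter≡count p (mycVertices n t) ⟩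
  count p (map inj₁ pairs ++ List.[ inj₂ tt ])
    ≡⟨ count-++ p (map inj₁ pairs) _ ⟩
  count p (map inj₁ pairs) + (iverson (p (inj₂ tt)) + 0)
    ≡⟨ cong₂ _+_ vertices (+-identityʳ _) ⟩
  ∑[ y < n ] ∑[ j < t ] iverson (p (inj₁ (y , j))) + iverson (p (inj₂ tt)) ∎
  where
  p = mycAdj t G v
  pairs = cartesianProduct (allFin n) (allFin t)
  vertices : count p (map inj₁ pairs)
             ≡ ∑[ y < n ] ∑[ j < t ] iverson (p (inj₁ (y , j)))
  vertices = begin
    count p (map inj₁ pairs)
      ≡⟨ count-map p inj₁ pairs ⟩
    count (p ∘ inj₁) pairs
      ≡⟨ count-cartesianProduct (p ∘ inj₁) id (allFin t) ⟩
    ∑[ y < n ] count (λ j → p (inj₁ (y , j))) (allFin t)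
      ≡⟨ sum-cong-≗ (λ (y : Fin n) → count-tabulate (λ j → p (inj₁ (y , j))) id) ⟩
    ∑[ y < n ] ∑[ j < t ] iverson (p (inj₁ (y , j))) ∎

mycDegree-layer : (G : Graph n) (x : Fin n) (i : Fin t) →
  mycDegree t G (inj₁ (x , i))
    ≡ degree G x * layerDegree t (toℕ i) + iverson (isLastLayer t (toℕ i))
mycDegree-layer {n} {t} G x i = begin
  mycDegree t G (inj₁ (x , i))
    ≡⟨ mycDegree≡∑ G (inj₁ (x , i)) ⟩
  ∑[ y < n ] ∑[ j < t ] iverson (adj G x y ∧ layerAdj a (toℕ j)) + l
    ≡⟨ cong (_+ l) (sum-cong-≗ edgesTo) ⟩
  ∑[ y < n ] (iverson (adj G x y) * layerDegree t a) + l
    ≡⟨ cong (_+ l) (*-distribʳ-sum (layerDegree t a) (iverson ∘ adj G x)) ⟨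
  degree G x * layerDegree t a + l ∎
  where
  a = toℕ i
  l = iverson (isLastLayer t a)
  edgesTo : ∀ y → ∑[ j < t ] iverson (adj G x y ∧ layerAdj a (toℕ j))
                    ≡ iverson (adj G x y) * layerDegree t a
  edgesTo y = begin
    ∑[ j < t ] iverson (adj G x y ∧ layerAdj a (toℕ j))
      ≡⟨ sum-cong-≗ (λ (j : Fin t) → iverson-∧ (adj G x y) (layerAdj a (toℕ j))) ⟩
    ∑[ j < t ] (iverson (adj G x y) * iverson (layerAdj a (toℕ j)))
      ≡⟨ *-distribˡ-sum (iverson (adj G x y)) (λ (j : Fin t) → iverson (layerAdj a (toℕ j))) ⟨
    iverson (adj G x y) * layerDegree t a ∎

mycDegree-apex : (G : Graph n) → mycDegree (suc t) G (inj₂ tt) ≡ n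
mycDegree-apex {n} {t} G = begin
  mycDegree (suc t) G (inj₂ tt)
    ≡⟨ mycDegree≡∑ G (inj₂ tt) ⟩
  ∑[ y < n ] ∑[ j < suc t ] iverson (toℕ j ≡ᵇ t) + 0
    ≡⟨ +-identityʳ _ ⟩
  ∑[ y < n ] ∑[ j < suc t ] iverson (toℕ j ≡ᵇ t)
    ≡⟨ sum-cong-≗ (λ (_ : Fin n) → trans (∑-iverson-toℕ≡ᵇ (suc t) t) (iverson-T (<⇒<ᵇ (n<1+n t)))) ⟩
  ∑[ y < n ] 1
    ≡⟨ ∑-one n ⟩
  n ∎

mycDegree-first-layer : (G : Graph n) (x : Fin n) →
  mycDegree (suc (suc t)) G (inj₁ (x , zero)) ≡ degree G x * 2
mycDegree-first-layer {t = t} G x = begin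
  mycDegree (suc (suc t)) G (inj₁ (x , zero))
    ≡⟨ mycDegree-layer G x zero ⟩
  degree G x * layerDegree (suc (suc t)) 0 + 0
    ≡⟨ +-identityʳ _ ⟩
  degree G x * layerDegree (suc (suc t)) 0
    ≡⟨ cong (degree G x *_) (trans (sym (+-identityʳ _)) (layerDegree+isLastLayer (suc (suc t)) 0 z<s)) ⟩
  degree G x * 2 ∎

mycDegree-last-layer : (G : Graph n) (x : Fin n) →
  mycDegree (suc t) G (inj₁ (x , fromℕ t)) ≡ degree G x + 1
mycDegree-last-layer {t = t} G x = begin
  mycDegree (suc t) G (inj₁ (x , fromℕ t))
    ≡⟨ mycDegree-layer G x (fromℕ t) ⟩
  degree G x * layerDegree (suc t) a + iverson (isLastLayer (suc t) a)
    ≡⟨ cong₂ (λ c l → degree G x * c + l) layerDegree≡1 isLast ⟩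
  degree G x * 1 + 1
    ≡⟨ cong (_+ 1) (*-identityʳ (degree G x)) ⟩
  degree G x + 1 ∎
  where
  a = toℕ (fromℕ t)
  isLast : iverson (isLastLayer (suc t) a) ≡ 1
  isLast = iverson-T (≡⇒≡ᵇ a t (toℕ-fromℕ t))
  layerDegree≡1 : layerDegree (suc t) a ≡ 1
  layerDegree≡1 = +-cancelʳ-≡ 1 _ 1 (begin
    layerDegree (suc t) a + 1                                ≡⟨ cong (layerDegree (suc t) a +_) isLast ⟨
    layerDegree (suc t) a + iverson (isLastLayer (suc t) a)  ≡⟨ layerDegree+isLastLayer (suc t) a (toℕ<n (fromℕ t)) ⟩
    2                                                        ∎)

degree-on-two-vertices : (G : Graph 2) (x : Fin 2) → degree G x ≡ iverson (adj G zero (suc zero))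
degree-on-two-vertices G zero =
  trans (cong (λ b → iverson b + (iverson (adj G zero (suc zero)) + 0)) (irrefl G zero))
        (+-identityʳ _)
degree-on-two-vertices G (suc zero) =
  trans (cong₂ (λ b c → iverson b + (iverson c + 0)) (Graph.sym G (suc zero) zero) (irrefl G (suc zero)))
        (+-identityʳ _)

adjacent⇒IsoK₂ : (G : Graph 2) → adj G zero (suc zero) ≡ true → IsoK₂ G
adjacent⇒IsoK₂ G adj₀₁ = ↔-refl , adj≡K₂adj
  where
  adj≡K₂adj : ∀ x y → adj G x y ≡ K₂adj x y
  adj≡K₂adj zero       zero       = irrefl G zero
  adj≡K₂adj zero       (suc zero) = adj₀₁
  adj≡K₂adj (suc zero) zero       = trans (Graph.sym G (suc zero) zero) adj₀₁
  adj≡K₂adj (suc zero) (suc zero) = irrefl G (suc zero)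

IsoK₂⇒adjacent : (G : Graph 2) → IsoK₂ G → adj G zero (suc zero) ≡ true
IsoK₂⇒adjacent G (f , adj≡K₂adj) =
  trans (adj≡K₂adj zero (suc zero))
        (cong (not ∘ ⌊_⌋) (dec-no (to zero ≟ to (suc zero)) images-distinct))
  where
  open Injection (↔⇒↣ f) using (to; injective)
  images-distinct : to zero ≢ to (suc zero)
  images-distinct eq with injective eq
  ... | ()

double≡suc⇒≡1 : ∀ d → d * 2 ≡ d + 1 → d ≡ 1
double≡suc⇒≡1 d eq = +-cancelˡ-≡ d d 1 (trans double eq)
  where
  double : d + d ≡ d * 2
  double = trans (cong (d +_) (sym (+-identityʳ d))) (*-comm 2 d)

mycRegular⇒IsoK₂ : (G : Graph n) → Fin n → MycRegular (suc (suc t)) G → IsoK₂ G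
mycRegular⇒IsoK₂ {n} {t} G x₀ (k , regular) = two-vertices n≡2 (degree≡1 x₀)
  where
  first last : Fin n → MVertex n (suc (suc t))
  first x = inj₁ (x , zero)
  last  x = inj₁ (x , fromℕ (suc t))
  degree≡1 : ∀ x → degree G x ≡ 1
  degree≡1 x = double≡suc⇒≡1 (degree G x) (begin
    degree G x * 2                   ≡⟨ mycDegree-first-layer G x ⟨
    mycDegree (suc (suc t)) G (first x) ≡⟨ regular (first x) ⟩
    k                                ≡⟨ regular (last x) ⟨
    mycDegree (suc (suc t)) G (last x)  ≡⟨ mycDegree-last-layer G x ⟩
    degree G x + 1                   ∎)
  n≡2 : n ≡ 2
  n≡2 = begin
    n                                    ≡⟨ mycDegree-apex G ⟨
    mycDegree (suc (suc t)) G (inj₂ tt)  ≡⟨ regular (inj₂ tt) ⟩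
    k                                    ≡⟨ regular (first x₀) ⟨
    mycDegree (suc (suc t)) G (first x₀) ≡⟨ mycDegree-first-layer G x₀ ⟩
    degree G x₀ * 2                      ≡⟨ cong (_* 2) (degree≡1 x₀) ⟩
    2                                    ∎
  two-vertices : n ≡ 2 → degree G x₀ ≡ 1 → IsoK₂ G
  two-vertices refl deg≡1 =
    adjacent⇒IsoK₂ G (iverson≡1⇒≡true (trans (sym (degree-on-two-vertices G x₀)) deg≡1))

IsoK₂⇒mycRegular : (G : Graph n) → IsoK₂ G → MycRegular (suc t) G
IsoK₂⇒mycRegular {t = t} G iso with ↔⇒≡ (proj₁ iso)
... | refl = 2 , regular
  where
  degree≡1 : ∀ x → degree G x ≡ 1
  degree≡1 x = trans (degree-on-two-vertices G x) (cong iverson (IsoK₂⇒adjacent G iso))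
  regular : ∀ v → mycDegree (suc t) G v ≡ 2
  regular (inj₁ (x , i)) = begin
    mycDegree (suc t) G (inj₁ (x , i))    ≡⟨ mycDegree-layer G x i ⟩
    degree G x * c + l                    ≡⟨ cong (λ d → d * c + l) (degree≡1 x) ⟩
    1 * c + l                             ≡⟨ cong (_+ l) (*-identityˡ c) ⟩
    c + l                                 ≡⟨ layerDegree+isLastLayer (suc t) (toℕ i) (toℕ<n i) ⟩
    2                                     ∎
    where
    c = layerDegree (suc t) (toℕ i)
    l = iverson (isLastLayer (suc t) (toℕ i))
  regular (inj₂ tt) = mycDegree-apex {t = t} G

-- Connectivity is used only for the existence of a vertex: for the empty graph M_t(G) is a
-- single isolated vertex, hence regular.
proposition2p2 : (t : ℕ) → t ≥ 3 → (n : ℕ) → (G : Graph n) → Connected G →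
    (MycRegular t G ⇔ IsoK₂ G)
proposition2p2 (suc (suc (suc t))) (s≤s (s≤s (s≤s _))) n G (x₀ , _) =
  mk⇔ (mycRegular⇒IsoK₂ G x₀) (IsoK₂⇒mycRegular G)
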